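{- For all integers $r \geq 3$, $t \geq r-2$ and $s,m \geq 0$, $$s_{r+s,t+s}(m+s) \geq s_{r,t}(m).$$
   Context: All graphs are finite and simple. For $r\ge 3$, an $r$-system is a pair $(H,\mathcal{F})$ where $H$ is a graph and $\mathcal{F}$ is a family of subsets of $V(H)$ such that: (i) $H$ contains no $K_r$; (ii) every $S\in\mathcal{F}$ is maximally $K_{r-1}$-free, i.e. $H[S]$ contains no $K_{r-1}$ but $H[S\cup\{v\}]$ contains a $K_{r-1}$ for every $v\notin S$; (iii) for distinct $S\neq T$ in $\mathcal{F}$, $H[S\cap T]$ contains a $K_{r-2}$. For $t\ge r-2$, an $(r,t)$-system is an $r$-system in which $\mathcal{F}$ has no repeated elements and all sets in $\mathcal{F}$ have size exactly $t$. $s_{r,t}(m)$ is the maximum of $|\mathcal{F}|$ over all $(r,t)$-systems $(H,\mathcal{F})$ with $|V(H)|=m$. -}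

module Defs where

open import Data.Nat using (ℕ; _≤_; _∸_)
open import Data.Bool using (Bool; true; false)
open import Data.Fin using (Fin)
open import Data.Fin.Subset using (Subset; _∈_; _∉_; _∩_; _∪_; ⁅_⁆; ∣_∣; ⊤)
open import Data.List using (List; length)
open import Data.List.Relation.Unary.All using (All)
open import Data.List.Relation.Unary.Unique.Propositional using (Unique)
import Data.List.Membership.Propositional as LM
open import Data.Product using (Σ; ∃; _×_)
open import Relation.Nullary using (¬_)
open import Relation.Binary.PropositionalEquality using (_≡_; _≢_)

record Graph (n : ℕ) : Set where
  field
    adj    : Fin n → Fin n → Bool
    sym    : ∀ u v → adj u v ≡ adj v u
    irrefl : ∀ v → adj v v ≡ false
open Graph public

-- H[S] contains a K_k: k pairwise adjacent (hence distinct) vertices, all in S.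
HasClique : {n : ℕ} → Graph n → ℕ → Subset n → Set
HasClique {n} G k S =
  Σ (Fin k → Fin n) λ f →
    (∀ i → f i ∈ S) × (∀ i j → i ≢ j → adj G (f i) (f j) ≡ true)

MaxFree : {n : ℕ} → Graph n → ℕ → Subset n → Set
MaxFree G k S = ¬ HasClique G k S × (∀ v → v ∉ S → HasClique G k (S ∪ ⁅ v ⁆))

IsRTSystem : (r t : ℕ) {m : ℕ} → Graph m → List (Subset m) → Set
IsRTSystem r t G F =
    ¬ HasClique G r ⊤
  × All (MaxFree G (r ∸ 1)) F
  × (∀ S T → S LM.∈ F → T LM.∈ F → S ≢ T → HasClique G (r ∸ 2) (S ∩ T))
  × Unique F
  × All (λ S → ∣ S ∣ ≡ t) F

Achievable : (r t m k : ℕ) → Set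
Achievable r t m k = Σ (Graph m) λ G → Σ (List (Subset m)) λ F →
  IsRTSystem r t G F × length F ≡ k

IsMax : (ℕ → Set) → ℕ → Set
IsMax P n = P n × (∀ k → P k → k ≤ n)

IsS : (r t m n : ℕ) → Set
IsS r t m n = IsMax (Achievable r t m) n

{-# OPTIONS --safe #-}
module Submission where

open import Defs hiding (sym)
open import Data.Nat using (ℕ; _+_; _∸_; _≤_; zero; suc; s≤s)
open import Data.Nat.Properties using (+-comm)
open import Data.Bool using (Bool; true; false)
open import Data.Fin using (Fin; zero; suc; punchIn; punchOut)
open import Data.Fin.Properties using (any?; punchIn-injective; punchInᵢ≢i; punchIn-punchOut; _≟_)
open import Data.Fin.Subset using (Subset; _∈_; _∉_; _∩_; _∪_; ⁅_⁆)
open import Data.Fin.Subset.Properties using (drop-there)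
open import Data.Vec using (_∷_; here; there)
open import Data.Vec.Properties using (∷-injectiveʳ)
open import Data.List using (List; map)
open import Data.List.Properties using (length-map)
open import Data.List.Relation.Unary.All as All using (All)
import Data.List.Relation.Unary.All.Properties as All
import Data.List.Relation.Unary.Unique.Propositional.Properties as Unique
import Data.List.Membership.Propositional as List
open import Data.List.Membership.Propositional.Properties using (∈-map⁻)
open import Data.Product using (∃; _,_)
open import Function using (_∘_)
open import Function.Definitions using (Injective)
open import Relation.Nullary using (yes; no; contradiction)
open import Relation.Nullary.Decidable using (decidable-stable)
open import Relation.Binary.PropositionalEquality
  using (_≡_; _≢_; refl; sym; trans; cong; subst; subst₂)

-- Coning off an (r,t)-system — adding a vertex adjacent to every other vertex and
-- putting it into every set of the family — yields an (r+1,t+1)-system of the same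
-- size on one more vertex: K_k's in the cone through the apex are exactly the
-- K_{k-1}'s of the old graph plus the apex, and a K_k avoiding the apex can be
-- shrunk to a K_{k-1}. Doing this s times gives s_{r+s,t+s}(m+s) ≥ s_{r,t}(m).

private
  variable
    k m n r t : ℕ

cone : Graph m → Graph (suc m)
cone G = record { adj = adj′ ; sym = sym′ ; irrefl = irrefl′ }
  where
  adj′ : Fin (suc _) → Fin (suc _) → Bool
  adj′ zero    zero    = false
  adj′ zero    (suc v) = true
  adj′ (suc u) zero    = true
  adj′ (suc u) (suc v) = adj G u v

  sym′ : ∀ u v → adj′ u v ≡ adj′ v u
  sym′ zero    zero    = refl
  sym′ zero    (suc v) = refl
  sym′ (suc u) zero    = refl
  sym′ (suc u) (suc v) = Graph.sym G u v

  irrefl′ : ∀ v → adj′ v v ≡ false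
  irrefl′ zero    = refl
  irrefl′ (suc v) = irrefl G v

clique-injective : (G : Graph n) {f : Fin k → Fin n} →
                   (∀ i j → i ≢ j → adj G (f i) (f j) ≡ true) →
                   Injective _≡_ _≡_ f
clique-injective G {f} f-adj {i} {j} fi≡fj = decidable-stable (i ≟ j) λ i≢j →
  contradiction (trans (sym (irrefl G (f j)))
                       (subst (λ u → adj G u (f j) ≡ true) fi≡fj (f-adj i j i≢j)))
                λ ()

-- An injection out of Fin (suc k) hits y at most once, so some punchIn p skips the preimage.
injective⇒punchIn-avoids : {f : Fin (suc k) → Fin n} → Injective _≡_ _≡_ f →
                           (y : Fin n) → ∃ λ p → ∀ i → y ≢ f (punchIn p i)
injective⇒punchIn-avoids {f = f} f-injective y with any? (λ p → f p ≟ y)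
... | yes (p , fp≡y) = p , λ i y≡f[pᵢ] →
  punchInᵢ≢i p i (f-injective (trans (sym y≡f[pᵢ]) (sym fp≡y)))
... | no ∄p = zero , λ i y≡f[pᵢ] → ∄p (suc i , sym y≡f[pᵢ])

cone-clique⁺ : (G : Graph m) {S : Subset m} →
               HasClique G k S → HasClique (cone G) (suc k) (true ∷ S)
cone-clique⁺ {m} {k} G {S} (f , f∈S , f-adj) = f′ , f′∈ , f′-adj
  where
  f′ : Fin (suc k) → Fin (suc m)
  f′ zero    = zero
  f′ (suc i) = suc (f i)

  f′∈ : ∀ i → f′ i ∈ true ∷ S
  f′∈ zero    = here
  f′∈ (suc i) = there (f∈S i)

  f′-adj : ∀ i j → i ≢ j → adj (cone G) (f′ i) (f′ j) ≡ true
  f′-adj zero    zero    0≢0 = contradiction refl 0≢0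
  f′-adj zero    (suc j) _   = refl
  f′-adj (suc i) zero    _   = refl
  f′-adj (suc i) (suc j) i≢j = f-adj i j (i≢j ∘ cong suc)

cone-clique⁻ : (G : Graph m) {b : Bool} {S : Subset m} →
               HasClique (cone G) (suc k) (b ∷ S) → HasClique G k S
cone-clique⁻ {m} {k} G {b} {S} (f , f∈ , f-adj)
  with injective⇒punchIn-avoids (clique-injective (cone G) {f} f-adj) zero
... | p , avoids-apex = g , g∈S , g-adj
  where
  g : Fin k → Fin m
  g i = punchOut (avoids-apex i)

  suc-g : ∀ i → suc (g i) ≡ f (punchIn p i)
  suc-g i = punchIn-punchOut (avoids-apex i)

  g∈S : ∀ i → g i ∈ S
  g∈S i = drop-there (subst (_∈ b ∷ S) (sym (suc-g i)) (f∈ (punchIn p i)))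

  g-adj : ∀ i j → i ≢ j → adj G (g i) (g j) ≡ true
  g-adj i j i≢j = subst₂ (λ u v → adj (cone G) u v ≡ true) (sym (suc-g i)) (sym (suc-g j))
                         (f-adj _ _ (i≢j ∘ punchIn-injective p i j))

cone-maxFree : (G : Graph m) {S : Subset m} →
               MaxFree G k S → MaxFree (cone G) (suc k) (true ∷ S)
cone-maxFree G {S} (S-Kk-free , S-maximal) = S-Kk-free ∘ cone-clique⁻ G , maximal
  where
  maximal : ∀ v → v ∉ true ∷ S → HasClique (cone G) _ ((true ∷ S) ∪ ⁅ v ⁆)
  maximal zero    apex∉ = contradiction here apex∉
  maximal (suc v) v∉    = cone-clique⁺ G (S-maximal v (v∉ ∘ there))

-- With r ≥ 2 none of r, r ∸ 1, r ∸ 2 truncates, so all three clique orders go up by one.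
cone-system : {G : Graph m} {F : List (Subset m)} → IsRTSystem (2 + r) t G F →
              IsRTSystem (3 + r) (suc t) (cone G) (map (true ∷_) F)
cone-system {r = r} {G = G} {F} (no-Kr , maxFree , intersecting , unique , sizes) =
    no-Kr ∘ cone-clique⁻ G
  , All.map⁺ (All.map (cone-maxFree G) maxFree)
  , intersecting′
  , Unique.map⁺ ∷-injectiveʳ unique
  , All.map⁺ (All.map (cong suc) sizes)
  where
  intersecting′ : ∀ S′ T′ → S′ List.∈ map (true ∷_) F → T′ List.∈ map (true ∷_) F →
                  S′ ≢ T′ → HasClique (cone G) (suc r) (S′ ∩ T′)
  intersecting′ S′ T′ S′∈ T′∈ S′≢T′ with ∈-map⁻ (true ∷_) S′∈ | ∈-map⁻ (true ∷_) T′∈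
  ... | S , S∈F , refl | T , T∈F , refl =
    cone-clique⁺ G (intersecting S T S∈F T∈F (S′≢T′ ∘ cong (true ∷_)))

cone-achievable : Achievable (2 + r) t m k → Achievable (3 + r) (suc t) (suc m) k
cone-achievable (G , F , system , |F|≡k) =
  cone G , map (true ∷_) F , cone-system system , trans (length-map (true ∷_) F) |F|≡k

iterated-cone-achievable : ∀ s → Achievable (2 + r) t m k →
                           Achievable (2 + r + s) (t + s) (m + s) k
iterated-cone-achievable {r} {t} {m} {k} s A
  rewrite +-comm r s | +-comm t s | +-comm m s = iterate s
  where
  iterate : ∀ s → Achievable (2 + (s + r)) (s + t) (s + m) k
  iterate zero    = A
  iterate (suc s) = cone-achievable (iterate s)

IsMax-mono : {P Q : ℕ → Set} {a b : ℕ} →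
             (∀ {k} → P k → Q k) → IsMax P a → IsMax Q b → a ≤ b
IsMax-mono P⇒Q (Pa , _) (_ , Q≤b) = Q≤b _ (P⇒Q Pa)

lemma19 : ∀ (r t s m : ℕ) → 3 ≤ r → r ∸ 2 ≤ t →
    ∀ (a b : ℕ) → IsS r t m a → IsS (r + s) (t + s) (m + s) b → a ≤ b
lemma19 (suc (suc r)) t s m (s≤s (s≤s _)) _ a b = IsMax-mono (iterated-cone-achievable s)
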